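{- For all positive integers $c,t$, every graph $G$ with treewidth at most $t$ has a $c$-colouring with clustering at most $(t+1)^{(c-1)/c}\,|V(G)|^{1/c}$.
   Context: All graphs are finite and simple. A colouring of a graph assigns a colour to each vertex (adjacent vertices may receive the same colour); a $c$-colouring uses at most $c$ colours. A monochromatic component is a connected component of the subgraph induced by the vertices of one colour. A colouring has clustering at most $k$ if every monochromatic component has at most $k$ vertices. -}

module Defs where

open import Data.Nat using (ℕ; zero; suc; _≤_)
open import Data.Fin using (Fin)
open import Data.Fin.Subset using (Subset; _∈_; ∣_∣)
open import Data.Bool using (Bool; true; false)
open import Data.List using (List; []; _∷_; _++_; length)
open import Data.List.Relation.Unary.All using (All)
open import Data.List.Relation.Unary.Unique.Propositional using (Unique)
open import Data.Product using (Σ; _×_; ∃)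
open import Data.Unit using (⊤)
open import Data.Empty using (⊥)
open import Relation.Binary.PropositionalEquality using (_≡_)

record Graph (n : ℕ) : Set where
  field
    adj    : Fin n → Fin n → Bool
    sym    : ∀ u v → adj u v ≡ adj v u
    irrefl : ∀ u → adj u u ≡ false
open Graph public

-- Walks from u to v in G all of whose vertices satisfy P
-- (i.e. walks in the subgraph induced by {x | P x}).
data Walk {n : ℕ} (G : Graph n) (P : Fin n → Set) : Fin n → Fin n → Set where
  here : ∀ {u} → P u → Walk G P u u
  step : ∀ {u w v} → P u → adj G u w ≡ true → Walk G P w v → Walk G P u v

Connected : ∀ {n} → Graph n → Set
Connected G = ∀ u v → Walk G (λ _ → ⊤) u v

Chain : ∀ {n} → Graph n → List (Fin n) → Set
Chain G []           = ⊤
Chain G (x ∷ [])     = ⊤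
Chain G (x ∷ y ∷ xs) = (adj G x y ≡ true) × Chain G (y ∷ xs)

IsCycle : ∀ {n} → Graph n → List (Fin n) → Set
IsCycle G []       = ⊥
IsCycle G (x ∷ xs) = (2 ≤ length xs) × Unique (x ∷ xs) × Chain G ((x ∷ xs) ++ (x ∷ []))

Acyclic : ∀ {n} → Graph n → Set
Acyclic G = ∀ xs → IsCycle G xs → ⊥

IsTree : ∀ {m} → Graph m → Set
IsTree T = Connected T × Acyclic T

record TreeDecomposition {n : ℕ} (G : Graph n) (t : ℕ) : Set where
  field
    m        : ℕ
    T        : Graph (suc m)
    isTree   : IsTree T
    bag      : Fin (suc m) → Subset n
    vertexIn : ∀ v → ∃ λ x → v ∈ bag x
    edgeIn   : ∀ u v → adj G u v ≡ true → ∃ λ x → (u ∈ bag x) × (v ∈ bag x)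
    subtree  : ∀ v x y → v ∈ bag x → v ∈ bag y → Walk T (λ z → v ∈ bag z) x y
    width    : ∀ x → ∣ bag x ∣ ≤ suc t

TreewidthAtMost : ∀ {n} → Graph n → ℕ → Set
TreewidthAtMost G t = TreeDecomposition G t

SameMonoComponent : ∀ {n c} → Graph n → (Fin n → Fin c) → Fin n → Fin n → Set
SameMonoComponent G col u w = Walk G (λ z → col z ≡ col u) u w

-- every monochromatic component has at most k vertices: every list of distinct
-- vertices in the monochromatic component of any vertex v has length at most k
ClusteringAtMost : ∀ {n c} → Graph n → (Fin n → Fin c) → ℕ → Set
ClusteringAtMost G col k =
  ∀ v (xs : List _) → Unique xs → All (SameMonoComponent G col v) xs → length xs ≤ k

-- Induction on the number of colours. For c + 1 colours and a vertex set U, let p be the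
-- integer part of ((t+1)^c |U|)^(1/(c+1)). Descending in the decomposition tree into a branch
-- whose bags still hold more than p vertices of U, one stops at a node x where U ∩ bag x cuts
-- off a piece of more than p vertices whose remaining components have at most p vertices.
-- Cutting off such pieces repeatedly gives a separator S, the union of k ≤ |U|/(p+1) bags,
-- such that G[U − S] has components of at most p vertices; these get the new colour. By
-- induction S has a c-colouring of clustering k′ with k′^c ≤ (t+1)^(c-1) |S|
-- ≤ (t+1)^c |U|/(p+1) < (p+1)^c, hence k′ ≤ p.

module Submission where

open import Data.Bool using (true) renaming (_≟_ to _≟ᵇ_)
open import Data.Fin using (Fin; zero; suc; _≟_)
open import Data.Fin.Properties using (any?; suc-injective)
open import Data.Fin.Subset
  using (Subset; inside; outside; _∈_; _∉_; _⊆_; ∣_∣; ⊤; _∩_; _∪_; _─_; _-_)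
  renaming (⊥ to ∅)
open import Data.Fin.Subset.Properties
  using ( _∈?_; _⊆?_; ∈⊤; ∣p∣≤n; ∣⊤∣≡n; ∣⊥∣≡0; p⊆q⇒∣p∣≤∣q∣; p⊂q⇒∣p∣<∣q∣
        ; x∈p⇒∣p-x∣<∣p∣; x∈p∧x≢y⇒x∈p-y; x∈p∧x∉q⇒x∈p─q; p─q⊆p
        ; x∈p∩q⁺; x∈p∩q⁻; p∩q⊆p; ∣p∩q∣≤∣q∣; p⊆p∪q; q⊆p∪q )
open import Data.List using (List; []; _∷_; _++_; length)
open import Data.List.Relation.Unary.All as All using (All; []; _∷_)
open import Data.List.Relation.Unary.All.Properties using (¬Any⇒All¬)
open import Data.List.Relation.Unary.AllPairs using ([]; _∷_)
open import Data.List.Relation.Unary.Any as Any using (Any)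
open import Data.List.Relation.Unary.Unique.Propositional using (Unique)
open import Data.Nat using (ℕ; zero; suc; _+_; _*_; _^_; _∸_; _≤_; _<_; z≤n; s≤s)
open import Data.Nat.Properties hiding (_≟_; suc-injective)
open import Data.Nat.Solver using (module +-*-Solver)
open import Data.Product using (Σ; ∃; ∃₂; _×_; _,_; proj₁; proj₂)
open import Data.Sum using (_⊎_; inj₁; inj₂)
open import Data.Unit using (tt)
open import Data.Vec using (tabulate; []; _∷_)
open import Data.Vec.Properties using (lookup∘tabulate; lookup⇒[]=; []=⇒lookup)
open import Function using (_∘_)
open import Relation.Binary.PropositionalEquality
open import Relation.Nullary using (Dec; yes; no; ¬_; ¬?; does; contradiction)
open import Relation.Nullary.Decidable using (dec-true; map′; _×-dec_)

open import Defs hiding (sym)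

-- Counting subsets of Fin n

∣p∪q∣≤∣p∣+∣q∣ : ∀ {n} (p q : Subset n) → ∣ p ∪ q ∣ ≤ ∣ p ∣ + ∣ q ∣
∣p∪q∣≤∣p∣+∣q∣ []            []            = z≤n
∣p∪q∣≤∣p∣+∣q∣ (outside ∷ p) (outside ∷ q) = ∣p∪q∣≤∣p∣+∣q∣ p q
∣p∪q∣≤∣p∣+∣q∣ (outside ∷ p) (inside  ∷ q) =
  ≤-trans (s≤s (∣p∪q∣≤∣p∣+∣q∣ p q)) (≤-reflexive (sym (+-suc ∣ p ∣ ∣ q ∣)))
∣p∪q∣≤∣p∣+∣q∣ (inside  ∷ p) (outside ∷ q) = s≤s (∣p∪q∣≤∣p∣+∣q∣ p q)
∣p∪q∣≤∣p∣+∣q∣ (inside  ∷ p) (inside  ∷ q) =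
  s≤s (≤-trans (∣p∪q∣≤∣p∣+∣q∣ p q) (+-monoʳ-≤ ∣ p ∣ (n≤1+n ∣ q ∣)))

∣p∩q∣+∣p─q∣≡∣p∣ : ∀ {n} (p q : Subset n) → ∣ p ∩ q ∣ + ∣ p ─ q ∣ ≡ ∣ p ∣
∣p∩q∣+∣p─q∣≡∣p∣ []            []            = refl
∣p∩q∣+∣p─q∣≡∣p∣ (outside ∷ p) (outside ∷ q) = ∣p∩q∣+∣p─q∣≡∣p∣ p q
∣p∩q∣+∣p─q∣≡∣p∣ (outside ∷ p) (inside  ∷ q) = ∣p∩q∣+∣p─q∣≡∣p∣ p q
∣p∩q∣+∣p─q∣≡∣p∣ (inside  ∷ p) (outside ∷ q) =
  trans (+-suc ∣ p ∩ q ∣ ∣ p ─ q ∣) (cong suc (∣p∩q∣+∣p─q∣≡∣p∣ p q))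
∣p∩q∣+∣p─q∣≡∣p∣ (inside  ∷ p) (inside  ∷ q) = cong suc (∣p∩q∣+∣p─q∣≡∣p∣ p q)

q⊆p⇒∣q∣+∣p─q∣≤∣p∣ : ∀ {n} {p q : Subset n} → q ⊆ p → ∣ q ∣ + ∣ p ─ q ∣ ≤ ∣ p ∣
q⊆p⇒∣q∣+∣p─q∣≤∣p∣ {p = p} {q} q⊆p = begin
  ∣ q ∣ + ∣ p ─ q ∣      ≤⟨ +-monoˡ-≤ ∣ p ─ q ∣ (p⊆q⇒∣p∣≤∣q∣ (λ x∈q → x∈p∩q⁺ (q⊆p x∈q , x∈q))) ⟩
  ∣ p ∩ q ∣ + ∣ p ─ q ∣  ≡⟨ ∣p∩q∣+∣p─q∣≡∣p∣ p q ⟩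
  ∣ p ∣                  ∎
  where open ≤-Reasoning

Unique⇒length≤∣p∣ : ∀ {n} {p : Subset n} {xs} → Unique xs → All (_∈ p) xs → length xs ≤ ∣ p ∣
Unique⇒length≤∣p∣ []             []            = z≤n
Unique⇒length≤∣p∣ {p = p} {x ∷ xs} (x∉xs ∷ xs-un) (x∈p ∷ xs⊆p) =
  ≤-trans (s≤s (Unique⇒length≤∣p∣ xs-un xs⊆p-x)) (x∈p⇒∣p-x∣<∣p∣ x∈p)
  where
  xs⊆p-x : All (_∈ p - x) xs
  xs⊆p-x = All.zipWith (λ (x≢y , y∈p) → x∈p∧x≢y⇒x∈p-y y∈p (x≢y ∘ sym)) (x∉xs , xs⊆p)

module _ {n : ℕ} {P : Fin n → Set} (P? : ∀ x → Dec (P x)) where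

  toSubset : Subset n
  toSubset = tabulate (does ∘ P?)

  ∈-toSubset⁺ : ∀ {x} → P x → x ∈ toSubset
  ∈-toSubset⁺ {x} px = lookup⇒[]= x toSubset (trans (lookup∘tabulate (does ∘ P?) x) (dec-true (P? x) px))

  ∈-toSubset⁻ : ∀ {x} → x ∈ toSubset → P x
  ∈-toSubset⁻ {x} x∈ with P? x | trans (sym (lookup∘tabulate (does ∘ P?) x)) ([]=⇒lookup x∈)
  ... | yes px | _  = px
  ... | no _   | ()

-- Walks

adj⇒≢ : ∀ {N} (H : Graph N) {a b} → adj H a b ≡ true → b ≢ a
adj⇒≢ H {a} e refl = contradiction (trans (sym (irrefl H a)) e) λ ()

module _ {N : ℕ} {H : Graph N} where

  mapʷ : ∀ {P Q : Fin N → Set} {a b} → (∀ {w} → P w → Q w) → Walk H P a b → Walk H Q a b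
  mapʷ f (here pa)     = here (f pa)
  mapʷ f (step pa e r) = step (f pa) e (mapʷ f r)

  startʷ : ∀ {P : Fin N → Set} {a b} → Walk H P a b → P a
  startʷ (here pa)    = pa
  startʷ (step pa _ _) = pa

  endʷ : ∀ {P : Fin N → Set} {a b} → Walk H P a b → P b
  endʷ (here pb)    = pb
  endʷ (step _ _ r) = endʷ r

  _++ʷ_ : ∀ {P : Fin N → Set} {a b c} → Walk H P a b → Walk H P b c → Walk H P a c
  here _     ++ʷ q = q
  step pa e r ++ʷ q = step pa e (r ++ʷ q)

  vertices : ∀ {P : Fin N → Set} {a b} → Walk H P a b → List (Fin N)
  vertices {a = a} (here _)     = a ∷ []
  vertices {a = a} (step _ _ r) = a ∷ vertices r

  All-vertices : ∀ {P : Fin N → Set} {a b} (w : Walk H P a b) → All P (vertices w)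
  All-vertices (here pa)     = pa ∷ []
  All-vertices (step pa _ r) = pa ∷ All-vertices r

  firstVisit : ∀ {P : Fin N → Set} x {a b} → Walk H P a b →
    Walk H (λ z → P z × z ≢ x) a b ⊎ Walk H P a x
  firstVisit x {a} w with a ≟ x
  ... | yes refl = inj₂ (here (startʷ w))
  firstVisit x (here pa)     | no a≢x = inj₁ (here (pa , a≢x))
  firstVisit x (step pa e r) | no a≢x with firstVisit x r
  ... | inj₁ r′ = inj₁ (step (pa , a≢x) e r′)
  ... | inj₂ r′ = inj₂ (step pa e r′)

  lastVisit : ∀ {P : Fin N → Set} x {a b} → Walk H P a b →
    Walk H (λ z → P z × z ≢ x) a b ⊎ x ≡ b ⊎ ∃ λ y → adj H x y ≡ true × Walk H (λ z → P z × z ≢ x) y b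
  lastVisit x {a} (here pa) with a ≟ x
  ... | yes refl = inj₂ (inj₁ refl)
  ... | no a≢x   = inj₁ (here (pa , a≢x))
  lastVisit x {a} (step pa e r) with lastVisit x r
  ... | inj₂ later = inj₂ later
  ... | inj₁ r′ with a ≟ x
  ...   | yes refl = inj₂ (inj₂ (_ , e , r′))
  ...   | no a≢x   = inj₁ (step (pa , a≢x) e r′)

  leave : ∀ {P : Fin N → Set} {a b} → Walk H P a b → a ≢ b →
    ∃ λ y → adj H a y ≡ true × Walk H (λ z → P z × z ≢ a) y b
  leave {a = a} w a≢b with lastVisit a w
  ... | inj₁ w′               = contradiction refl (proj₂ (startʷ w′))
  ... | inj₂ (inj₁ a≡b)       = contradiction a≡b a≢b
  ... | inj₂ (inj₂ departure) = departure

  suffixFrom : ∀ {P : Fin N → Set} {a b c} (w : Walk H P a c) → Any (b ≡_) (vertices w) →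
    Σ (Walk H P b c) λ q → Unique (vertices w) → Unique (vertices q)
  suffixFrom (here pa)     (Any.here refl) = here pa , λ un → un
  suffixFrom (step pa e r) (Any.here refl) = step pa e r , λ un → un
  suffixFrom (step pa e r) (Any.there b∈r) with suffixFrom r b∈r
  ... | q , shrink = q , λ { (_ ∷ un) → shrink un }

  toPath : ∀ {P : Fin N → Set} {a b} → Walk H P a b → Σ (Walk H P a b) (Unique ∘ vertices)
  toPath (here pa) = here pa , [] ∷ []
  toPath {a = a} (step pa e r) with toPath r
  ... | q , q-un with Any.any? (a ≟_) (vertices q)
  ...   | yes a∈q = let (q′ , shrink) = suffixFrom q a∈q in q′ , shrink q-un
  ...   | no a∉q  = step pa e q , ¬Any⇒All¬ (vertices q) a∉q ∷ q-un

  2≤length-vertices : ∀ {P : Fin N → Set} {a b} → a ≢ b → (w : Walk H P a b) → 2 ≤ length (vertices w)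
  2≤length-vertices a≢b (here _)                = contradiction refl a≢b
  2≤length-vertices a≢b (step _ _ (here _))     = s≤s (s≤s z≤n)
  2≤length-vertices a≢b (step _ _ (step _ _ _)) = s≤s (s≤s z≤n)

  Chain-vertices : ∀ {P : Fin N → Set} {a b c d} → adj H c a ≡ true → (w : Walk H P a b) →
    adj H b d ≡ true → Chain H (c ∷ vertices w ++ d ∷ [])
  Chain-vertices c~a (here _)     b~d = c~a , b~d , tt
  Chain-vertices c~a (step _ e r) b~d = c~a , Chain-vertices e r b~d

  -- x ~ y ~ y′ together with such a walk would close a cycle through y.
  Acyclic⇒¬return : Acyclic H → ∀ {x y y′} → adj H x y ≡ true → adj H y y′ ≡ true → y′ ≢ x →
    ¬ Walk H (_≢ y) y′ x
  Acyclic⇒¬return acyclic {y = y} x~y y~y′ y′≢x w with toPath w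
  ... | q , q-un = acyclic (y ∷ vertices q)
    ( 2≤length-vertices y′≢x q
    , All.map (λ z≢y y≡z → z≢y (sym y≡z)) (All-vertices q) ∷ q-un
    , Chain-vertices y~y′ q x~y )

  stayOutside : ∀ {P : Fin N → Set} {W : Subset N} →
    (∀ {u u′} → u ∈ W → P u → P u′ → adj H u u′ ≡ true → u′ ∈ W) →
    ∀ {a b} → a ∉ W → Walk H P a b → Walk H (λ z → P z × z ∉ W) a b
  stayOutside closed a∉W (here pa) = here (pa , a∉W)
  stayOutside {W = W} closed {a} a∉W (step {w = w} pa e r) = step (pa , a∉W) e (stayOutside closed w∉W r)
    where
    w∉W : w ∉ W
    w∉W = λ w∈W → a∉W (closed w∈W (startʷ r) pa (trans (Graph.sym H _ a) e))

module _ {N : ℕ} (H : Graph N) {P : Fin N → Set} (P? : ∀ w → Dec (P w)) where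

  -- A walk from a within A leaves a for the last time towards a neighbour, and then stays in A - a.
  walkWithin? : ∀ f (A : Subset N) → ∣ A ∣ < f → ∀ a b → Dec (Walk H (λ z → P z × z ∈ A) a b)
  walkWithin? (suc f) A ∣A∣<1+f a b with P? a ×-dec a ∈? A | a ≟ b
  ... | no ¬pa           | _        = no (¬pa ∘ startʷ)
  ... | yes pa           | yes refl = yes (here pa)
  ... | yes pa@(_ , a∈A) | no a≢b   =
    map′ (λ (y , a~y , r) → step pa a~y (mapʷ (λ (py , y∈A-a) → py , p─q⊆p A _ y∈A-a) r))
         (λ w → let (y , a~y , r) = leave w a≢b
                in y , a~y , mapʷ (λ ((py , y∈A) , y≢a) → py , x∈p∧x≢y⇒x∈p-y y∈A y≢a) r)
         (any? λ y → (adj H a y ≟ᵇ true) ×-dec walkWithin? f (A - a) ∣A-a∣<f y b)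
    where
    ∣A-a∣<f : ∣ A - a ∣ < f
    ∣A-a∣<f = ≤-trans (x∈p⇒∣p-x∣<∣p∣ a∈A) (≤-pred ∣A∣<1+f)

  walk? : ∀ a b → Dec (Walk H P a b)
  walk? a b = map′ (mapʷ proj₁) (mapʷ (λ pz → pz , ∈⊤)) (walkWithin? (suc N) ⊤ (s≤s (∣p∣≤n ⊤)) a b)

ComponentAtMost : ∀ {n} → Graph n → (Fin n → Set) → Fin n → ℕ → Set
ComponentAtMost G P v k = ∃ λ Z → ∣ Z ∣ ≤ k × (∀ {z} → Walk G P v z → z ∈ Z)

ComponentAtMost-weaken : ∀ {n} {G : Graph n} {P Q : Fin n → Set} {v k k′} →
  (∀ {z} → Walk G Q v z → Walk G P v z) → k ≤ k′ → ComponentAtMost G P v k → ComponentAtMost G Q v k′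
ComponentAtMost-weaken walks k≤k′ (Z , ∣Z∣≤k , ⊆Z) = Z , ≤-trans ∣Z∣≤k k≤k′ , ⊆Z ∘ walks

-- Tree decompositions

module _ {n t : ℕ} {G : Graph n} (D : TreeDecomposition G t) where
  open TreeDecomposition D

  Node : Set
  Node = Fin (suc m)

  branch? : (x y : Node) → ∀ z → Dec (Walk T (_≢ x) y z)
  branch? x y = walk? T (λ z → ¬? (z ≟ x)) y

  -- Opaque, so that the nodes can be inferred from membership goals.
  opaque
    branch : Node → Node → Subset (suc m)
    branch x y = toSubset (branch? x y)

    ∈-branch⁺ : ∀ {x y z} → Walk T (_≢ x) y z → z ∈ branch x y
    ∈-branch⁺ {x} {y} = ∈-toSubset⁺ (branch? x y)

    ∈-branch⁻ : ∀ {x y z} → z ∈ branch x y → Walk T (_≢ x) y z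
    ∈-branch⁻ {x} {y} = ∈-toSubset⁻ (branch? x y)

  bagsOf? : (R : Subset (suc m)) → ∀ v → Dec (∃ λ z → z ∈ R × v ∈ bag z)
  bagsOf? R v = any? (λ z → z ∈? R ×-dec v ∈? bag z)

  opaque
    bagsOf : Subset (suc m) → Subset n
    bagsOf R = toSubset (bagsOf? R)

    ∈-bagsOf⁺ : ∀ {R z v} → z ∈ R → v ∈ bag z → v ∈ bagsOf R
    ∈-bagsOf⁺ {R} z∈R v∈z = ∈-toSubset⁺ (bagsOf? R) (_ , z∈R , v∈z)

    ∈-bagsOf⁻ : ∀ {R v} → v ∈ bagsOf R → ∃ λ z → z ∈ R × v ∈ bag z
    ∈-bagsOf⁻ {R} = ∈-toSubset⁻ (bagsOf? R)

  bagsOf-mono : ∀ {R R′} → R ⊆ R′ → bagsOf R ⊆ bagsOf R′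
  bagsOf-mono R⊆R′ v∈R with ∈-bagsOf⁻ v∈R
  ... | z , z∈R , v∈z = ∈-bagsOf⁺ (R⊆R′ z∈R) v∈z

  -- The nodes whose bags contain v form a subtree, which avoids x when v ∉ bag x.
  bagsOf-branch-edge : ∀ {x y v v′} → v ∈ bagsOf (branch x y) → v ∉ bag x → adj G v v′ ≡ true →
    v′ ∈ bagsOf (branch x y)
  bagsOf-branch-edge {x} {v = v} {v′} v∈B v∉x v~v′ with ∈-bagsOf⁻ v∈B | edgeIn v v′ v~v′
  ... | z , z∈B , v∈z | z′ , v∈z′ , v′∈z′ = ∈-bagsOf⁺ (∈-branch⁺ (∈-branch⁻ z∈B ++ʷ avoid-x)) v′∈z′
    where
    avoid-x : Walk T (_≢ x) z z′
    avoid-x = mapʷ (λ v∈w w≡x → v∉x (subst (λ w → v ∈ bag w) w≡x v∈w)) (subtree v z z′ v∈z v∈z′)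

  bagsOf-branch-walk : ∀ {x y v z} → v ∈ bagsOf (branch x y) → Walk G (_∉ bag x) v z →
    z ∈ bagsOf (branch x y)
  bagsOf-branch-walk v∈B (here _)         = v∈B
  bagsOf-branch-walk v∈B (step v∉x v~w r) = bagsOf-branch-walk (bagsOf-branch-edge v∈B v∉x v~w) r

  x∉branch : ∀ {x y} → x ∉ branch x y
  x∉branch x∈B = endʷ (∈-branch⁻ x∈B) refl

  neighbour∈branch : ∀ {x y} → adj T x y ≡ true → y ∈ branch x y
  neighbour∈branch x~y = ∈-branch⁺ (here (adj⇒≢ T x~y))

  branch-nested : ∀ {x y y′} → adj T x y ≡ true → adj T y y′ ≡ true → y′ ≢ x →
    branch y y′ ⊆ branch x y
  branch-nested {x} x~y y~y′ y′≢x z∈B with firstVisit x (∈-branch⁻ z∈B)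
  ... | inj₁ avoids-x = ∈-branch⁺ (step (adj⇒≢ T x~y) y~y′ (mapʷ proj₂ avoids-x))
  ... | inj₂ returns  = contradiction returns (Acyclic⇒¬return (proj₂ isTree) x~y y~y′ y′≢x)

  branch-shrinks : ∀ {x y R} → branch x y ⊆ R → x ∈ R → ∣ branch x y ∣ < ∣ R ∣
  branch-shrinks B⊆R x∈R = p⊂q⇒∣p∣<∣q∣ (B⊆R , _ , x∈R , x∉branch)

  WholeBranches : Node → Subset (suc m) → Set
  WholeBranches x R =
    ∀ {z} → z ∈ R → z ≢ x → ∃ λ y → adj T x y ≡ true × z ∈ branch x y × branch x y ⊆ R

  WholeBranches-⊤ : ∀ {x} → WholeBranches x ⊤
  WholeBranches-⊤ {x} {z} _ z≢x with leave (proj₁ isTree x z) (z≢x ∘ sym)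
  ... | y , x~y , r = y , x~y , ∈-branch⁺ (mapʷ proj₂ r) , λ _ → ∈⊤

  WholeBranches-branch : ∀ {x y} → adj T x y ≡ true → WholeBranches y (branch x y)
  WholeBranches-branch x~y z∈B z≢y with leave (∈-branch⁻ z∈B) (z≢y ∘ sym)
  ... | y′ , y~y′ , r =
    y′ , y~y′ , ∈-branch⁺ (mapʷ proj₂ r) , branch-nested x~y y~y′ (proj₁ (startʷ r))

  enclosingBranch : ∀ {x R v} → WholeBranches x R → v ∈ bagsOf R → v ∉ bag x →
    ∃ λ y → adj T x y ≡ true × branch x y ⊆ R × v ∈ bagsOf (branch x y)
  enclosingBranch whole v∈R v∉x with ∈-bagsOf⁻ v∈R
  ... | z , z∈R , v∈z with whole z∈R (λ { refl → v∉x v∈z })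
  ...   | y , x~y , z∈B , B⊆R = y , x~y , B⊆R , ∈-bagsOf⁺ z∈B v∈z

  module _ (p : ℕ) (U : Subset n) where

    record Piece (x : Node) (W : Subset n) : Set where
      field
        W⊆U     : W ⊆ U
        heavy   : p < ∣ W ∣
        U∩bag⊆W : U ∩ bag x ⊆ W
        closed  : ∀ {u u′} → u ∈ W → u ∉ bag x → u′ ∈ U → adj G u u′ ≡ true → u′ ∈ W
        light   : ∀ {v} → v ∈ W → v ∉ bag x → ComponentAtMost G (λ w → w ∈ U × w ∉ bag x) v p

    Heavy : Subset (suc m) → Set
    Heavy R = p < ∣ U ∩ bagsOf R ∣

    HeavyBranch : Node → Subset (suc m) → Node → Set
    HeavyBranch x R y = adj T x y ≡ true × branch x y ⊆ R × Heavy (branch x y)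

    heavyBranch? : ∀ x R y → Dec (HeavyBranch x R y)
    heavyBranch? x R y =
      (adj T x y ≟ᵇ true) ×-dec branch x y ⊆? R ×-dec p <? ∣ U ∩ bagsOf (branch x y) ∣

    pieceAt : ∀ {x R} → WholeBranches x R → x ∈ R → Heavy R → (∀ y → ¬ HeavyBranch x R y) →
      Piece x (U ∩ bagsOf R)
    pieceAt {x} {R} whole x∈R heavy noHeavyBranch = record
      { W⊆U     = p∩q⊆p U (bagsOf R)
      ; heavy   = heavy
      ; U∩bag⊆W = λ v∈ → let (v∈U , v∈x) = x∈p∩q⁻ U (bag x) v∈ in x∈p∩q⁺ (v∈U , ∈-bagsOf⁺ x∈R v∈x)
      ; closed  = closed
      ; light   = light
      }
      where
      closed : ∀ {u u′} → u ∈ U ∩ bagsOf R → u ∉ bag x → u′ ∈ U → adj G u u′ ≡ true →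
        u′ ∈ U ∩ bagsOf R
      closed u∈W u∉x u′∈U u~u′ =
        let (_ , _ , B⊆R , u∈B) = enclosingBranch whole (proj₂ (x∈p∩q⁻ U _ u∈W)) u∉x
        in x∈p∩q⁺ (u′∈U , bagsOf-mono B⊆R (bagsOf-branch-edge u∈B u∉x u~u′))

      light : ∀ {v} → v ∈ U ∩ bagsOf R → v ∉ bag x →
        ComponentAtMost G (λ w → w ∈ U × w ∉ bag x) v p
      light v∈W v∉x =
        let (y , x~y , B⊆R , v∈B) = enclosingBranch whole (proj₂ (x∈p∩q⁻ U _ v∈W)) v∉x
        in U ∩ bagsOf (branch x y)
         , ≮⇒≥ (λ heavyB → noHeavyBranch y (x~y , B⊆R , heavyB))
         , λ r → x∈p∩q⁺ (proj₁ (endʷ r) , bagsOf-branch-walk v∈B (mapʷ proj₂ r))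

    descend : ∀ f x R → ∣ R ∣ < f → WholeBranches x R → x ∈ R → Heavy R → ∃₂ Piece
    descend (suc f) x R ∣R∣<1+f whole x∈R heavy with any? (heavyBranch? x R)
    ... | no noHeavyBranch = x , _ , pieceAt whole x∈R heavy (λ y hb → noHeavyBranch (y , hb))
    ... | yes (y , x~y , B⊆R , heavyB) =
      descend f y (branch x y) (<-≤-trans (branch-shrinks B⊆R x∈R) (≤-pred ∣R∣<1+f))
        (WholeBranches-branch x~y) (neighbour∈branch x~y) heavyB

    heavyPiece : p < ∣ U ∣ → ∃₂ Piece
    heavyPiece p<∣U∣ =
      descend (suc (suc m)) zero ⊤ (s≤s (∣p∣≤n ⊤)) WholeBranches-⊤ ∈⊤ (<-≤-trans p<∣U∣ (p⊆q⇒∣p∣≤∣q∣ U⊆))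
      where
      U⊆ : U ⊆ U ∩ bagsOf ⊤
      U⊆ {v} v∈U = x∈p∩q⁺ (v∈U , ∈-bagsOf⁺ ∈⊤ (proj₂ (vertexIn v)))

  -- Each of the pieces cut off has more than p vertices of U and adds one bag to the separator.
  record Separation (p : ℕ) (U : Subset n) : Set where
    field
      separator      : Subset n
      pieces         : ℕ
      separator-size : ∣ separator ∣ ≤ suc t * pieces
      pieces-size    : pieces * suc p ≤ ∣ U ∣
      components     : ∀ {v} → v ∈ U → v ∉ separator →
                         ComponentAtMost G (λ w → w ∈ U × w ∉ separator) v p

  Separation-∪-piece : ∀ {p U x W} → Piece p U x W → Separation p (U ─ W) → Separation p U
  Separation-∪-piece {p} {U} {x} {W} piece sep = record
    { separator      = S ∪ U ∩ bag x
    ; pieces         = suc k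
    ; separator-size = begin
        ∣ S ∪ U ∩ bag x ∣        ≤⟨ ∣p∪q∣≤∣p∣+∣q∣ S (U ∩ bag x) ⟩
        ∣ S ∣ + ∣ U ∩ bag x ∣    ≤⟨ +-mono-≤ separator-size (≤-trans (∣p∩q∣≤∣q∣ U (bag x)) (width x)) ⟩
        suc t * k + suc t        ≡⟨ +-comm (suc t * k) (suc t) ⟩
        suc t + suc t * k        ≡⟨ *-suc (suc t) k ⟨
        suc t * suc k            ∎
    ; pieces-size    = begin
        suc p + k * suc p        ≤⟨ +-mono-≤ heavy pieces-size ⟩
        ∣ W ∣ + ∣ U ─ W ∣        ≤⟨ q⊆p⇒∣q∣+∣p─q∣≤∣p∣ W⊆U ⟩
        ∣ U ∣                    ∎
    ; components     = components′
    }
    where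
    open ≤-Reasoning
    open Piece piece
    open Separation sep renaming (separator to S; pieces to k)

    ∉bag : ∀ {w} → w ∈ U → w ∉ S ∪ U ∩ bag x → w ∉ bag x
    ∉bag w∈U w∉S′ w∈x = w∉S′ (q⊆p∪q S (U ∩ bag x) (x∈p∩q⁺ (w∈U , w∈x)))

    ∉S : ∀ {w} → w ∉ S ∪ U ∩ bag x → w ∉ S
    ∉S w∉S′ w∈S = w∉S′ (p⊆p∪q (U ∩ bag x) w∈S)

    components′ : ∀ {v} → v ∈ U → v ∉ S ∪ U ∩ bag x →
      ComponentAtMost G (λ w → w ∈ U × w ∉ S ∪ U ∩ bag x) v p
    components′ {v} v∈U v∉S′ with v ∈? W
    ... | yes v∈W = ComponentAtMost-weaken (mapʷ (λ (w∈U , w∉S′) → w∈U , ∉bag w∈U w∉S′)) ≤-refl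
                      (light v∈W (∉bag v∈U v∉S′))
    ... | no v∉W = ComponentAtMost-weaken (mapʷ inRest ∘ stayOutside closed′ v∉W) ≤-refl
                      (components (x∈p∧x∉q⇒x∈p─q v∈U v∉W) (∉S v∉S′))
      where
      closed′ : ∀ {u u′} → u ∈ W → u ∈ U × u ∉ S ∪ U ∩ bag x → u′ ∈ U × u′ ∉ S ∪ U ∩ bag x →
        adj G u u′ ≡ true → u′ ∈ W
      closed′ u∈W (u∈U , u∉S′) (u′∈U , _) = closed u∈W (∉bag u∈U u∉S′) u′∈U
      inRest : ∀ {w} → (w ∈ U × w ∉ S ∪ U ∩ bag x) × w ∉ W → w ∈ U ─ W × w ∉ S
      inRest ((w∈U , w∉S′) , w∉W) = x∈p∧x∉q⇒x∈p─q w∈U w∉W , ∉S w∉S′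

  separation : ∀ p U → Separation p U
  separation p U = separationWithin (suc n) U (s≤s (∣p∣≤n U))
    where
    separationWithin : ∀ f U → ∣ U ∣ < f → Separation p U
    separationWithin (suc f) U ∣U∣<1+f with ∣ U ∣ ≤? p
    ... | yes ∣U∣≤p = record
      { separator      = ∅
      ; pieces         = 0
      ; separator-size = ≤-trans (≤-reflexive (∣⊥∣≡0 n)) z≤n
      ; pieces-size    = z≤n
      ; components     = λ _ _ → U , ∣U∣≤p , proj₁ ∘ endʷ
      }
    ... | no ∣U∣≰p with heavyPiece p U (≰⇒> ∣U∣≰p)
    ...   | x , W , piece = Separation-∪-piece piece (separationWithin f (U ─ W) ∣U─W∣<f)
      where
      open Piece piece
      ∣U─W∣<f : ∣ U ─ W ∣ < f
      ∣U─W∣<f = ≤-trans (+-monoˡ-≤ ∣ U ─ W ∣ (≤-trans (s≤s z≤n) heavy))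
                        (≤-trans (q⊆p⇒∣q∣+∣p─q∣≤∣p∣ W⊆U) (≤-pred ∣U∣<1+f))

-- Colouring

recolour : ∀ {n c} → Subset n → (Fin n → Fin c) → Fin n → Fin (suc c)
recolour S col w with w ∈? S
... | yes _ = suc (col w)
... | no _  = zero

recolour-∈ : ∀ {n c} {S : Subset n} {col : Fin n → Fin c} {v w} → v ∈ S →
  recolour S col w ≡ recolour S col v → w ∈ S × col w ≡ col v
recolour-∈ {S = S} {v = v} {w} v∈S same with v ∈? S | w ∈? S
... | no v∉S | _       = contradiction v∈S v∉S
... | yes _  | yes w∈S = w∈S , suc-injective same
... | yes _  | no _    with () ← same

recolour-∉ : ∀ {n c} {S : Subset n} {col : Fin n → Fin c} {v w} → v ∉ S →
  recolour S col w ≡ recolour S col v → w ∉ S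
recolour-∉ {S = S} {v = v} {w} v∉S same with v ∈? S | w ∈? S
... | yes v∈S | _      = contradiction v∈S v∉S
... | no _    | no w∉S = w∉S
... | no _    | yes _  with () ← same

⌊root⌋ : ∀ c B → ∃ λ p → p ^ suc c ≤ B × B < suc p ^ suc c
⌊root⌋ c zero = 0 , z≤n , m^n>0 1 (suc c)
⌊root⌋ c (suc B) with ⌊root⌋ c B
... | p , p^≤B , B<[1+p]^ with suc p ^ suc c ≤? suc B
...   | yes [1+p]^≤1+B = suc p , [1+p]^≤1+B , ≤-<-trans B<[1+p]^ (^-monoˡ-< (suc c) (n<1+n (suc p)))
...   | no [1+p]^≰1+B  = p , ≤-trans p^≤B (n≤1+n B) , ≰⇒> [1+p]^≰1+B

p<k⇒[1+p]^[2+c]≤a^[1+c]*u : ∀ {a c k p s l u} → p < k → k ^ suc c ≤ a ^ c * s → s ≤ a * l →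
  l * suc p ≤ u → suc p ^ suc (suc c) ≤ a ^ suc c * u
p<k⇒[1+p]^[2+c]≤a^[1+c]*u {a} {c} {k} {p} {l = l} {u} p<k k^≤ s≤ l[1+p]≤u = begin
  suc p * suc p ^ suc c   ≤⟨ *-monoʳ-≤ (suc p) (^-monoˡ-≤ (suc c) p<k) ⟩
  suc p * k ^ suc c       ≤⟨ *-monoʳ-≤ (suc p) (≤-trans k^≤ (*-monoʳ-≤ (a ^ c) s≤)) ⟩
  suc p * (a ^ c * (a * l)) ≡⟨ rearrange (suc p) (a ^ c) a l ⟩
  a * a ^ c * (l * suc p) ≤⟨ *-monoʳ-≤ (a * a ^ c) l[1+p]≤u ⟩
  a * a ^ c * u           ∎
  where
  open ≤-Reasoning
  open +-*-Solver
  rearrange : ∀ q b a l → q * (b * (a * l)) ≡ a * b * (l * q)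
  rearrange = solve 4 (λ q b a l → q :* (b :* (a :* l)) := a :* b :* (l :* q)) refl

record ClusteredColouring {n} (G : Graph n) (t c : ℕ) (U : Subset n) : Set where
  field
    colour           : Fin n → Fin (suc c)
    clustering       : ℕ
    clustering-bound : clustering ^ suc c ≤ suc t ^ c * ∣ U ∣
    components       : ∀ {v} → v ∈ U →
                         ComponentAtMost G (λ w → w ∈ U × colour w ≡ colour v) v clustering

colouring : ∀ {n t} {G : Graph n} → TreeDecomposition G t → ∀ c U → ClusteredColouring G t c U
colouring D zero U = record
  { colour           = λ _ → zero
  ; clustering       = ∣ U ∣
  ; clustering-bound = ≤-reflexive (*-comm ∣ U ∣ 1)
  ; components       = λ _ → U , ≤-refl , proj₁ ∘ endʷ
  }
colouring {t = t} {G} D (suc c) U with ⌊root⌋ (suc c) (suc t ^ suc c * ∣ U ∣)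
... | p , p^≤B , B<[1+p]^ = record
  { colour           = recolour separator colour
  ; clustering       = p
  ; clustering-bound = p^≤B
  ; components       = components′
  }
  where
  open Separation (separation D p U) renaming (components to separation-components)
  open ClusteredColouring (colouring D c separator)

  clustering≤p : clustering ≤ p
  clustering≤p = ≮⇒≥ λ p<k → <⇒≱ B<[1+p]^
    (p<k⇒[1+p]^[2+c]≤a^[1+c]*u {suc t} {c} p<k clustering-bound separator-size pieces-size)

  components′ : ∀ {v} → v ∈ U →
    ComponentAtMost G (λ w → w ∈ U × recolour separator colour w ≡ recolour separator colour v) v p
  components′ {v} v∈U = case (v ∈? separator)
    where
    -- Matching here rather than with-abstracting v ∈? separator, which would also unfold
    -- recolour separator colour v inside the goal.
    case : Dec (v ∈ separator) →
      ComponentAtMost G (λ w → w ∈ U × recolour separator colour w ≡ recolour separator colour v) v p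
    case (yes v∈S) = ComponentAtMost-weaken (mapʷ (λ (_ , same) → recolour-∈ v∈S same)) clustering≤p
                       (components v∈S)
    case (no v∉S)  = ComponentAtMost-weaken (mapʷ (λ (w∈U , same) → w∈U , recolour-∉ v∉S same)) ≤-refl
                       (separation-components v∈U v∉S)

lemma21 : (c t : ℕ) → 1 ≤ c → 1 ≤ t → (n : ℕ) → (G : Graph n) → TreewidthAtMost G t →
    Σ (Fin n → Fin c) λ col → ∃ λ k → ClusteringAtMost G col k × (k ^ c ≤ (suc t) ^ (c ∸ 1) * n)
lemma21 (suc c) t _ _ n G D =
  colour , clustering , clusteringAtMost ,
  ≤-trans clustering-bound (≤-reflexive (cong (suc t ^ c *_) (∣⊤∣≡n n)))
  where
  open ClusteredColouring (colouring D c ⊤)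

  clusteringAtMost : ClusteringAtMost G colour clustering
  clusteringAtMost v xs unique inComponent with components {v} ∈⊤
  ... | Z , ∣Z∣≤k , ⊆Z =
    ≤-trans (Unique⇒length≤∣p∣ unique (All.map (⊆Z ∘ mapʷ (∈⊤ ,_)) inComponent)) ∣Z∣≤k
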